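{- Let $H$ be a $3$-hypergraph, $\pi$ a quasigraph in $H$, $X\subseteq V(H)$, and $e$ a hyperedge of $H$ with $|e\cap X|\leq 1$. If $\pi$ is anticonnected on $X$ in $H$, then $\pi$ (restricted to the hyperedges of $H-e$) is anticonnected on $X$ in $H-e$.
   Context: A $3$-hypergraph is a finite hypergraph all of whose hyperedges have size $2$ or $3$. A quasigraph $\pi$ in $H$ is a map assigning to each hyperedge $e$ of $H$ either a $2$-element subset of $e$ or the empty set. $H-e$ is the hypergraph obtained by deleting the hyperedge $e$. For $X\subseteq V(H)$, $\pi$ is anticonnected on $X$ in a hypergraph $H'$ (with $\pi$ defined on its hyperedges) if for every partition $\mathcal R$ of $X$ with at least two classes there is a hyperedge $f$ of $H'$ intersecting at least two classes of $\mathcal R$ such that $\pi(f)$ is a subset of one class of $\mathcal R$ (possibly $\pi(f)=\emptyset$). -}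

module Defs where

open import Data.Nat using (ℕ; _≤_)
open import Data.Fin using (Fin)
open import Data.Fin.Subset using (Subset; _∈_; _⊆_; ∣_∣; ⊥; _∩_)
open import Data.Product using (Σ; ∃; _×_; ∃-syntax; proj₁)
open import Data.Sum using (_⊎_)
open import Relation.Binary.PropositionalEquality using (_≡_; _≢_)

record Hypergraph3 (n m : ℕ) : Set where
  field
    edge : Fin m → Subset n
    size : (f : Fin m) → (∣ edge f ∣ ≡ 2) ⊎ (∣ edge f ∣ ≡ 3)
open Hypergraph3 public

record Quasigraph {n m : ℕ} (H : Hypergraph3 n m) : Set where
  field
    π    : Fin m → Subset n
    okπ  : (f : Fin m) → (π f ≡ ⊥) ⊎ ((π f ⊆ edge H f) × (∣ π f ∣ ≡ 2))
open Quasigraph public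

-- A partition of X with at least two classes is given by a labelling
-- c : Fin n → ℕ whose classes are the nonempty fibres restricted to X;
-- "at least two classes" = two vertices of X with distinct labels.
AtLeastTwoClasses : {n : ℕ} → Subset n → (Fin n → ℕ) → Set
AtLeastTwoClasses X c = ∃[ x ] ∃[ y ] (x ∈ X × y ∈ X × c x ≢ c y)

MeetsTwoClasses : {n : ℕ} → Subset n → (Fin n → ℕ) → Subset n → Set
MeetsTwoClasses X c S = ∃[ u ] ∃[ v ] (u ∈ S × v ∈ S × u ∈ X × v ∈ X × c u ≢ c v)

InOneClass : {n : ℕ} → Subset n → (Fin n → ℕ) → Subset n → Set
InOneClass {n} X c P = ∃[ x ] (x ∈ X × ((v : Fin n) → v ∈ P → (v ∈ X × c v ≡ c x)))

Anticonnected : {n : ℕ} (E : Set) → (E → Subset n) → (E → Subset n) → Subset n → Set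
Anticonnected {n} E ed p X =
  (c : Fin n → ℕ) → AtLeastTwoClasses X c →
  ∃[ f ] (MeetsTwoClasses X c (ed f) × InOneClass X c (p f))

AnticonnIn : {n m : ℕ} (H : Hypergraph3 n m) → Quasigraph H → Subset n → Set
AnticonnIn {m = m} H Q X = Anticonnected (Fin m) (edge H) (π Q) X

AnticonnInMinus : {n m : ℕ} (H : Hypergraph3 n m) → Quasigraph H → Fin m → Subset n → Set
AnticonnInMinus {m = m} H Q e X =
  Anticonnected (Σ (Fin m) (λ f → f ≢ e)) (λ f → edge H (proj₁ f))
                (λ f → π Q (proj₁ f)) X

-- An edge that meets two classes of a partition of X contains two distinct
-- vertices of X, so an edge with |e ∩ X| ≤ 1 never witnesses anticonnectedness;
-- every witness found in H therefore survives in H − e.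
module Submission where

open import Defs
open import Data.Nat using (ℕ; _≤_; _<_; z≤n)
open import Data.Nat.Properties using (≤-<-trans; <⇒≱)
open import Data.Fin using (Fin; _≟_)
open import Data.Fin.Subset using (Subset; ∣_∣; _∩_; _∈_)
open import Data.Fin.Subset.Properties using (x∈p∩q⁺; x∈p∧x≢y⇒x∈p-y; x∈p⇒∣p-x∣<∣p∣)
open import Data.Empty using (⊥-elim)
open import Data.Product using (Σ; _,_; proj₁)
open import Function using (_∘_)
open import Relation.Binary.Definitions using (DecidableEquality)
open import Relation.Binary.PropositionalEquality using (refl; sym; cong; _≢_)
open import Relation.Nullary using (yes; no)

x∈p⇒0<∣p∣ : ∀ {n} {x : Fin n} {p : Subset n} → x ∈ p → 0 < ∣ p ∣
x∈p⇒0<∣p∣ x∈p = ≤-<-trans z≤n (x∈p⇒∣p-x∣<∣p∣ x∈p)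

x∈p∧y∈p∧x≢y⇒1<∣p∣ : ∀ {n} {x y : Fin n} {p : Subset n} →
                     x ∈ p → y ∈ p → x ≢ y → 1 < ∣ p ∣
x∈p∧y∈p∧x≢y⇒1<∣p∣ x∈p y∈p x≢y =
  ≤-<-trans (x∈p⇒0<∣p∣ (x∈p∧x≢y⇒x∈p-y y∈p (x≢y ∘ sym))) (x∈p⇒∣p-x∣<∣p∣ x∈p)

meetsTwoClasses⇒1<∣S∩X∣ : ∀ {n} {X S : Subset n} {c : Fin n → ℕ} →
                           MeetsTwoClasses X c S → 1 < ∣ S ∩ X ∣
meetsTwoClasses⇒1<∣S∩X∣ {c = c} (u , v , u∈S , v∈S , u∈X , v∈X , cu≢cv) =
  x∈p∧y∈p∧x≢y⇒1<∣p∣ (x∈p∩q⁺ (u∈S , u∈X)) (x∈p∩q⁺ (v∈S , v∈X)) (cu≢cv ∘ cong c)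

anticonnected-delete : ∀ {n} {E : Set} → DecidableEquality E →
                       (ed p : E → Subset n) (X : Subset n) (e : E) →
                       ∣ ed e ∩ X ∣ ≤ 1 →
                       Anticonnected E ed p X →
                       Anticonnected (Σ E (λ f → f ≢ e)) (ed ∘ proj₁) (p ∘ proj₁) X
anticonnected-delete _≟E_ ed p X e ∣e∩X∣≤1 anticonn c twoClasses
  with anticonn c twoClasses
... | f , meets , inOne with f ≟E e
...   | no f≢e  = (f , f≢e) , meets , inOne
...   | yes refl = ⊥-elim (<⇒≱ (meetsTwoClasses⇒1<∣S∩X∣ meets) ∣e∩X∣≤1)

lemma3 : {n m : ℕ} (H : Hypergraph3 n m) (Q : Quasigraph H) (X : Subset n) (e : Fin m) →
         ∣ edge H e ∩ X ∣ ≤ 1 →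
         AnticonnIn H Q X → AnticonnInMinus H Q e X
lemma3 H Q = anticonnected-delete _≟_ (edge H) (π Q)
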